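{- Let $n\ge 1$, $1\le a\le n$, $b=n-a$. Let $\pi=(\pi(1),\dots,\pi(a))$ be a sequence of distinct elements of $[n]$ and $\theta$ an ordering of $[n]\setminus\{\pi(1),\dots,\pi(a)\}$. Let $\sigma$ be a shuffle of $\theta$ and $\pi$. For $i=1,\dots,a$ let $\sigma_i$ be the subword of $\sigma$ consisting of the letters of $\theta$ together with $\pi(i),\dots,\pi(a)$, with $\sigma_{a+1}=\theta$; let $m_i=\mathrm{maj}(\sigma_i)-\mathrm{maj}(\sigma_{i+1})$ and $t_i=m_i-d_i(\pi)$. Then $t_i\in\{0,1,\dots,b\}$ for all $i\in[a]$.
   Context: For a word $w=w(1)\cdots w(m)$ of distinct integers, index $i\in\{1,\dots,m-1\}$ is a descent if $w(i)>w(i+1)$; $\mathrm{maj}(w)$ is the sum of the descents of $w$; $d_k(w)$ is the number of descents of $w$ that are $\ge k$. A shuffle of $\theta$ and $\pi$ is a word of length $n$ containing both $\theta$ and $\pi$ as subwords. -}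

module Defs where

open import Data.Nat using (ℕ; zero; suc; _<ᵇ_; _≤ᵇ_; _≟_; _∸_)
open import Data.Bool using (Bool; true; false; if_then_else_; _∨_)
open import Data.Nat.ListAction using (sum)
open import Data.List using (List; []; _∷_; length; filterᵇ; drop; _++_)

descentsFrom : ℕ → List ℕ → List ℕ
descentsFrom k [] = []
descentsFrom k (x ∷ []) = []
descentsFrom k (x ∷ y ∷ rest) =
  if y <ᵇ x then k ∷ descentsFrom (suc k) (y ∷ rest)
            else descentsFrom (suc k) (y ∷ rest)

-- the set of descents of w, i.e. indices i ∈ {1,…,m-1} with w(i) > w(i+1)
descents : List ℕ → List ℕ
descents = descentsFrom 1

maj : List ℕ → ℕ
maj w = sum (descents w)

d : ℕ → List ℕ → ℕ
d k w = length (filterᵇ (λ i → k ≤ᵇ i) (descents w))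

elemᵇ : ℕ → List ℕ → Bool
elemᵇ x [] = false
elemᵇ x (y ∷ ys) = (Data.Nat._≡ᵇ_ x y) ∨ elemᵇ x ys

subwordOn : List ℕ → List ℕ → List ℕ
subwordOn L σ = filterᵇ (λ x → elemᵇ x L) σ

sigmaSub : (a : ℕ) → (θ π σ : List ℕ) → ℕ → List ℕ
sigmaSub a θ π σ i =
  if i ≤ᵇ a then subwordOn (θ ++ drop (i ∸ 1) π) σ else θ

module Submission where

-- Passing from σᵢ to σᵢ₊₁ deletes the single
-- letter x = π(i): σᵢ = u ++ x ∷ v and σᵢ₊₁ = u ++ v, where v contains the
-- suffix p = π(i+1),…,π(a) as a subword.
--
-- Deleting x from u ++ x ∷ v moves the
--    descents behind x one gap to the left, lowering maj by des (x ∷ v), and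
--    changes the descent at the junction gap |u| by c ∈ {0, 1} (maj-delete).
--    A subword loses at most one descent per deleted letter (des-sublist).
--    Hence maj (u ++ x ∷ v) = maj (u ++ v) + des (x ∷ p) + t with
--    t + |p| ≤ |u| + |v| (maj-deletion).
-- 2. dᵢ(π) counts the descents of π at gaps ≥ i, i.e. the descents of the
--    suffix x ∷ p (d-drop).
-- 3. Lists without repetitions.  A pigeonhole principle and the behaviour
--    of subwordOn under deleting one letter of the alphabet.
-- 4. The shuffle setting (module Shuffle).  σ has n letters covering [n], so
--    it has no repeated letter; this identifies σᵢ, σᵢ₊₁ with u ++ x ∷ v and
--    u ++ v and gives |u| + |v| ≤ |θ| + |p| with |θ| ≤ n − a.  So tᵢ = t is
--    a natural number at most n − a, which is the theorem.

open import Defs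
open import Data.Nat using (ℕ; zero; suc; _≤_; _<_; _∸_; _+_; _*_; _<ᵇ_; _≤ᵇ_; _≡ᵇ_; _≟_; z≤n; s≤s)
open import Data.Nat.Properties
open import Algebra.Properties.CommutativeSemigroup +-commutativeSemigroup
  using () renaming (xy∙z≈xz∙y to +-right-comm)
open import Data.Nat.ListAction using (sum)
open import Data.Nat.Tactic.RingSolver using (solve-∀)
open import Data.Bool using (Bool; true; false; T; T?; _∨_)
open import Data.Bool.Properties using (T-∨)
open import Data.Integer using (+_; _-_; _⊖_; +≤+) renaming (_≤_ to _≤ℤ_)
import Data.Integer.Properties as ℤ
open import Data.List using (List; []; _∷_; _++_; length; drop; filterᵇ; map; upTo)
import Data.List.Properties as List
open import Data.List.Relation.Unary.All as All using (All; []; _∷_)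
open import Data.List.Relation.Unary.All.Properties using (¬Any⇒All¬; All¬⇒¬Any)
open import Data.List.Relation.Unary.Any using (here; there)
open import Data.List.Relation.Unary.Unique.Propositional using (Unique; []; _∷_)
import Data.List.Relation.Unary.Unique.Propositional.Properties as Unique
open import Data.List.Membership.Propositional using (_∈_; _∉_)
open import Data.List.Membership.Propositional.Properties using (∈-∃++; ∈-++⁻; ∈-++⁺ˡ; ∈-++⁺ʳ; ∈-map⁻; ∈-upTo⁻; ∈-filter⁻)
open import Data.List.Membership.DecPropositional _≟_ using (_∈?_)
open import Data.List.Relation.Binary.Sublist.Propositional using (_⊆_; []; _∷_; _∷ʳ_; ⊆-trans; lookup)
open import Data.List.Relation.Binary.Sublist.Propositional.Properties using (drop-⊆; filter⁺; length-mono-≤; to-≋)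
open import Data.List.Relation.Binary.Equality.Propositional using (≋⇒≡)
open import Data.Product using (Σ; _×_; _,_; proj₂)
open import Data.Sum using (inj₁; inj₂)
open import Function using (_∘_; Equivalence)
open import Relation.Binary.PropositionalEquality
open import Relation.Nullary using (¬_; yes; no)
open import Relation.Nullary.Reflects using (ofʸ; ofⁿ)
open import Data.Empty using (⊥-elim)
open import Data.Unit using (tt)
open import Relation.Unary using (Decidable)

ind : Bool → ℕ
ind true = 1
ind false = 0

ind≤1 : ∀ b → ind b ≤ 1
ind≤1 true = ≤-refl
ind≤1 false = z≤n

majFrom : ℕ → List ℕ → ℕ
majFrom k w = sum (descentsFrom k w)

des : List ℕ → ℕ
des w = length (descents w)

descentsFrom-suc : ∀ k w → descentsFrom (suc k) w ≡ map suc (descentsFrom k w)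
descentsFrom-suc k [] = refl
descentsFrom-suc k (x ∷ []) = refl
descentsFrom-suc k (x ∷ y ∷ r) with ih ← descentsFrom-suc (suc k) (y ∷ r) | y <ᵇ x
... | true = cong (suc k ∷_) ih
... | false = ih

length-descentsFrom : ∀ k w → length (descentsFrom k w) ≡ des w
length-descentsFrom zero w =
  sym (trans (cong length (descentsFrom-suc 0 w)) (List.length-map suc (descentsFrom 0 w)))
length-descentsFrom (suc k) w =
  trans (cong length (descentsFrom-suc k w))
        (trans (List.length-map suc (descentsFrom k w)) (length-descentsFrom k w))

sum-map-suc : ∀ l → sum (map suc l) ≡ sum l + length l
sum-map-suc [] = refl
sum-map-suc (x ∷ l) = begin
  suc x + sum (map suc l)     ≡⟨ cong (λ s → suc x + s) (sum-map-suc l) ⟩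
  suc x + (sum l + length l)  ≡⟨ cong suc (+-assoc x (sum l) (length l)) ⟨
  suc (x + sum l + length l)  ≡⟨ +-suc (x + sum l) (length l) ⟨
  x + sum l + suc (length l)  ∎
  where open ≡-Reasoning

majFrom-suc : ∀ k w → majFrom (suc k) w ≡ majFrom k w + des w
majFrom-suc k w = begin
  sum (descentsFrom (suc k) w)                        ≡⟨ cong sum (descentsFrom-suc k w) ⟩
  sum (map suc (descentsFrom k w))                    ≡⟨ sum-map-suc (descentsFrom k w) ⟩
  majFrom k w + length (descentsFrom k w)             ≡⟨ cong (λ s → majFrom k w + s) (length-descentsFrom k w) ⟩
  majFrom k w + des w                                 ∎
  where open ≡-Reasoning

majFrom-∷∷ : ∀ k x y r → majFrom k (x ∷ y ∷ r) ≡ ind (y <ᵇ x) * k + majFrom (suc k) (y ∷ r)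
majFrom-∷∷ k x y r with y <ᵇ x
... | true = cong (_+ majFrom (suc k) (y ∷ r)) (sym (+-identityʳ k))
... | false = refl

des-∷∷ : ∀ x y r → des (x ∷ y ∷ r) ≡ ind (y <ᵇ x) + des (y ∷ r)
des-∷∷ x y r with y <ᵇ x
... | true = cong suc (length-descentsFrom 2 (y ∷ r))
... | false = length-descentsFrom 2 (y ∷ r)

descent-triangle : ∀ x y z → Σ ℕ λ c → c ≤ 1 × ind (x <ᵇ y) + ind (z <ᵇ x) ≡ ind (z <ᵇ y) + c
descent-triangle x y z
  with x <ᵇ y | <ᵇ-reflects-< x y | z <ᵇ x | <ᵇ-reflects-< z x | z <ᵇ y | <ᵇ-reflects-< z y
... | true  | _        | true  | _        | true  | _       = 1 , ≤-refl , refl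
... | true  | ofʸ x<y  | true  | ofʸ z<x  | false | ofⁿ z≮y = ⊥-elim (z≮y (<-trans z<x x<y))
... | true  | _        | false | _        | true  | _       = 0 , z≤n , refl
... | true  | _        | false | _        | false | _       = 1 , ≤-refl , refl
... | false | _        | true  | _        | true  | _       = 0 , z≤n , refl
... | false | _        | true  | _        | false | _       = 1 , ≤-refl , refl
... | false | ofⁿ x≮y  | false | ofⁿ z≮x  | true  | ofʸ z<y =
  ⊥-elim (<⇒≱ z<y (≤-trans (≮⇒≥ x≮y) (≮⇒≥ z≮x)))
... | false | _        | false | _        | false | _       = 0 , z≤n , refl

-- Deleting the letter x from u ++ x ∷ v (gaps numbered from k + 1): the
-- descents behind x move one gap to the left, which removes des (x ∷ v), and
-- the descent at the junction gap k + |u| changes by c ∈ {0, 1}.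
maj-delete : ∀ k u x v → Σ ℕ λ c → c ≤ 1 ×
  majFrom (suc k) (u ++ x ∷ v) ≡ majFrom (suc k) (u ++ v) + des (x ∷ v) + c * (k + length u)
maj-delete k [] x [] = 0 , z≤n , refl
maj-delete k [] x (y ∷ v) = ind b , ind≤1 b , (begin
  majFrom (suc k) (x ∷ y ∷ v)                             ≡⟨ majFrom-∷∷ (suc k) x y v ⟩
  ind b * suc k + majFrom (suc (suc k)) (y ∷ v)            ≡⟨ cong (λ s → ind b * suc k + s) (majFrom-suc (suc k) (y ∷ v)) ⟩
  ind b * suc k + (M + des (y ∷ v))                       ≡⟨ normalise (ind b) k M (des (y ∷ v)) ⟩
  M + (ind b + des (y ∷ v)) + ind b * (k + 0)             ≡⟨ cong (λ s → M + s + ind b * (k + 0)) (des-∷∷ x y v) ⟨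
  M + des (x ∷ y ∷ v) + ind b * (k + 0)                   ∎)
  where
  open ≡-Reasoning
  b = y <ᵇ x
  M = majFrom (suc k) (y ∷ v)
  normalise : ∀ c k M D → c * suc k + (M + D) ≡ M + (c + D) + c * (k + 0)
  normalise = solve-∀
maj-delete k (y ∷ []) x [] = ind (x <ᵇ y) , ind≤1 _ ,
  trans (majFrom-∷∷ (suc k) y x []) (normalise (ind (x <ᵇ y)) k)
  where
  normalise : ∀ c k → c * suc k + 0 ≡ 0 + 0 + c * (k + 1)
  normalise = solve-∀
maj-delete k (y ∷ []) x (z ∷ v) with descent-triangle x y z
... | c , c≤1 , triangle = c , c≤1 , (begin
  majFrom (suc k) (y ∷ x ∷ z ∷ v)                         ≡⟨ majFrom-∷∷ (suc k) y x (z ∷ v) ⟩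
  δyx * suc k + majFrom (2 + k) (x ∷ z ∷ v)                ≡⟨ cong (λ s → δyx * suc k + s) (majFrom-∷∷ (2 + k) x z v) ⟩
  δyx * suc k + (δxz * (2 + k) + majFrom (3 + k) (z ∷ v))  ≡⟨ cong (λ s → δyx * suc k + (δxz * (2 + k) + s)) (majFrom-suc (2 + k) (z ∷ v)) ⟩
  δyx * suc k + (δxz * (2 + k) + (M + D))                  ≡⟨ regroup δyx δxz k M D ⟩
  (δyx + δxz) * suc k + (δxz + M + D)                      ≡⟨ cong (λ s → s * suc k + (δxz + M + D)) triangle ⟩
  (δyz + c) * suc k + (δxz + M + D)                        ≡⟨ distribute δxz δyz c k M D ⟩
  (δyz * suc k + M) + (δxz + D) + c * (k + 1)              ≡⟨ cong₂ (λ s s′ → s + s′ + c * (k + 1)) (majFrom-∷∷ (suc k) y z v) (des-∷∷ x z v) ⟨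
  majFrom (suc k) (y ∷ z ∷ v) + des (x ∷ z ∷ v) + c * (k + 1) ∎)
  where
  open ≡-Reasoning
  δyx = ind (x <ᵇ y)
  δxz = ind (z <ᵇ x)
  δyz = ind (z <ᵇ y)
  M = majFrom (2 + k) (z ∷ v)
  D = des (z ∷ v)
  regroup : ∀ a b k M D → a * suc k + (b * suc (suc k) + (M + D)) ≡ (a + b) * suc k + (b + M + D)
  regroup = solve-∀
  distribute : ∀ b a c k M D → (a + c) * suc k + (b + M + D) ≡ (a * suc k + M) + (b + D) + c * (k + 1)
  distribute = solve-∀
maj-delete k (y ∷ y′ ∷ u) x v with maj-delete (suc k) (y′ ∷ u) x v
... | c , c≤1 , ih = c , c≤1 , (begin
  majFrom (suc k) (y ∷ y′ ∷ u ++ x ∷ v)                        ≡⟨ majFrom-∷∷ (suc k) y y′ (u ++ x ∷ v) ⟩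
  δ * suc k + majFrom (2 + k) (y′ ∷ u ++ x ∷ v)                 ≡⟨ cong (λ s → δ * suc k + s) ih ⟩
  δ * suc k + (M + E + c * (suc k + suc (length u)))            ≡⟨ regroup δ k M E c (length u) ⟩
  (δ * suc k + M) + E + c * (k + suc (suc (length u)))          ≡⟨ cong (λ s → s + E + c * (k + suc (suc (length u)))) (majFrom-∷∷ (suc k) y y′ (u ++ v)) ⟨
  majFrom (suc k) (y ∷ y′ ∷ u ++ v) + E + c * (k + suc (suc (length u))) ∎)
  where
  open ≡-Reasoning
  δ = ind (y′ <ᵇ y)
  M = majFrom (2 + k) (y′ ∷ u ++ v)
  E = des (x ∷ v)
  regroup : ∀ δ k M E c L → δ * suc k + (M + E + c * (suc k + suc L)) ≡ (δ * suc k + M) + E + c * (k + suc (suc L))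
  regroup = solve-∀

-- Deleting one letter changes the number of descents only at the gaps next
-- to it, and by at most one.
des-delete : ∀ u x v → Σ ℕ λ e → e ≤ 1 × des (u ++ x ∷ v) ≡ des (u ++ v) + e
des-delete [] x [] = 0 , z≤n , refl
des-delete [] x (y ∷ v) = ind (y <ᵇ x) , ind≤1 _ ,
  trans (des-∷∷ x y v) (+-comm (ind (y <ᵇ x)) (des (y ∷ v)))
des-delete (y ∷ []) x [] = ind (x <ᵇ y) , ind≤1 _ , trans (des-∷∷ y x []) (+-identityʳ _)
des-delete (y ∷ []) x (z ∷ v) with descent-triangle x y z
... | c , c≤1 , triangle = c , c≤1 , (begin
  des (y ∷ x ∷ z ∷ v)              ≡⟨ des-∷∷ y x (z ∷ v) ⟩
  δyx + des (x ∷ z ∷ v)            ≡⟨ cong (λ s → δyx + s) (des-∷∷ x z v) ⟩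
  δyx + (δxz + D)                  ≡⟨ +-assoc δyx δxz D ⟨
  (δyx + δxz) + D                  ≡⟨ cong (_+ D) triangle ⟩
  (δyz + c) + D                    ≡⟨ +-right-comm δyz c D ⟩
  (δyz + D) + c                    ≡⟨ cong (_+ c) (des-∷∷ y z v) ⟨
  des (y ∷ z ∷ v) + c              ∎)
  where
  open ≡-Reasoning
  δyx = ind (x <ᵇ y)
  δxz = ind (z <ᵇ x)
  δyz = ind (z <ᵇ y)
  D = des (z ∷ v)
des-delete (y ∷ y′ ∷ u) x v with des-delete (y′ ∷ u) x v
... | e , e≤1 , ih = e , e≤1 , (begin
  des (y ∷ y′ ∷ u ++ x ∷ v)        ≡⟨ des-∷∷ y y′ (u ++ x ∷ v) ⟩
  δ + des (y′ ∷ u ++ x ∷ v)        ≡⟨ cong (λ s → δ + s) ih ⟩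
  δ + (des (y′ ∷ u ++ v) + e)      ≡⟨ +-assoc δ _ e ⟨
  δ + des (y′ ∷ u ++ v) + e        ≡⟨ cong (_+ e) (des-∷∷ y y′ (u ++ v)) ⟨
  des (y ∷ y′ ∷ u ++ v) + e        ∎)
  where
  open ≡-Reasoning
  δ = ind (y′ <ᵇ y)

des-sublist : ∀ u {s w} → s ⊆ w →
  Σ ℕ λ f → des (u ++ w) ≡ des (u ++ s) + f × f + length s ≤ length w
des-sublist u [] = 0 , sym (+-identityʳ _) , z≤n
des-sublist u {s} {y ∷ w} (.y ∷ʳ s⊆w) with des-sublist u s⊆w | des-delete u y w
... | f , ih , f+|s|≤|w| | e , e≤1 , deleted = f + e , des-eq , bound
  where
  des-eq : des (u ++ y ∷ w) ≡ des (u ++ s) + (f + e)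
  des-eq = trans deleted (trans (cong (_+ e) ih) (+-assoc (des (u ++ s)) f e))
  bound : f + e + length s ≤ suc (length w)
  bound = begin
    f + e + length s       ≡⟨ +-right-comm f e (length s) ⟩
    f + length s + e       ≤⟨ +-monoʳ-≤ (f + length s) e≤1 ⟩
    f + length s + 1       ≡⟨ +-comm (f + length s) 1 ⟩
    suc (f + length s)     ≤⟨ s≤s f+|s|≤|w| ⟩
    suc (length w)         ∎
    where open ≤-Reasoning
des-sublist u {y ∷ s} {y ∷ w} (refl ∷ s⊆w) with des-sublist (u ++ y ∷ []) s⊆w
... | f , ih , f+|s|≤|w| =
  f , subst₂ (λ w′ s′ → des w′ ≡ des s′ + f) (List.++-assoc u (y ∷ []) w) (List.++-assoc u (y ∷ []) s) ih
    , subst (_≤ suc (length w)) (sym (+-suc f (length s))) (s≤s f+|s|≤|w|)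

maj-deletion : ∀ u x {p v} → p ⊆ v →
  Σ ℕ λ t → maj (u ++ x ∷ v) ≡ maj (u ++ v) + des (x ∷ p) + t × t + length p ≤ length u + length v
maj-deletion u x {p} {v} p⊆v with maj-delete 0 u x v | des-sublist [] (refl ∷ p⊆v)
... | c , c≤1 , maj-eq | f , des-eq , f+|xp|≤|xv| = f + c * length u , excess-eq , bound
  where
  excess-eq : maj (u ++ x ∷ v) ≡ maj (u ++ v) + des (x ∷ p) + (f + c * length u)
  excess-eq = begin
    maj (u ++ x ∷ v)                                   ≡⟨ maj-eq ⟩
    maj (u ++ v) + des (x ∷ v) + c * length u          ≡⟨ cong (λ s → maj (u ++ v) + s + c * length u) des-eq ⟩
    maj (u ++ v) + (des (x ∷ p) + f) + c * length u    ≡⟨ regroup (maj (u ++ v)) (des (x ∷ p)) f (c * length u) ⟩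
    maj (u ++ v) + des (x ∷ p) + (f + c * length u)    ∎
    where
    open ≡-Reasoning
    regroup : ∀ M D f X → M + (D + f) + X ≡ M + D + (f + X)
    regroup = solve-∀
  bound : f + c * length u + length p ≤ length u + length v
  bound = begin
    f + c * length u + length p   ≡⟨ +-right-comm f (c * length u) (length p) ⟩
    f + length p + c * length u   ≤⟨ +-mono-≤ (≤-pred (subst (_≤ suc (length v)) (+-suc f (length p)) f+|xp|≤|xv|))
                                               (≤-trans (*-monoˡ-≤ (length u) c≤1) (≤-reflexive (*-identityˡ (length u)))) ⟩
    length v + length u           ≡⟨ +-comm (length v) (length u) ⟩
    length u + length v           ∎
    where open ≤-Reasoning

descentsFrom-≥ : ∀ k w → All (k ≤_) (descentsFrom k w)
descentsFrom-≥ k [] = []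
descentsFrom-≥ k (x ∷ []) = []
descentsFrom-≥ k (x ∷ y ∷ r) with later ← All.map (≤-trans (n≤1+n k)) (descentsFrom-≥ (suc k) (y ∷ r)) | y <ᵇ x
... | true = ≤-refl ∷ later
... | false = later

descents-beyond : ∀ j k w → length (filterᵇ (j + k ≤ᵇ_) (descentsFrom k w)) ≡ des (drop j w)
descents-beyond zero k w =
  trans (cong length (List.filter-all (T? ∘ (k ≤ᵇ_)) (All.map ≤⇒≤ᵇ (descentsFrom-≥ k w))))
        (length-descentsFrom k w)
descents-beyond (suc j) k [] = refl
descents-beyond (suc j) k (x ∷ []) = cong des (sym (List.drop-[] j))
descents-beyond (suc j) k (x ∷ y ∷ r)
  with beyond ← subst (λ i → length (filterᵇ (i ≤ᵇ_) (descentsFrom (suc k) (y ∷ r))) ≡ des (drop j (y ∷ r)))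
                      (+-suc j k) (descents-beyond j (suc k) (y ∷ r))
     | y <ᵇ x
... | true = trans (cong length (List.filter-reject (T? ∘ (suc j + k ≤ᵇ_)) {k} {descentsFrom (suc k) (y ∷ r)} k-too-small)) beyond
  where
  k-too-small : ¬ T (suc j + k ≤ᵇ k)
  k-too-small t = 1+n≰n (≤-trans (s≤s (m≤n+m k j)) (≤ᵇ⇒≤ (suc j + k) k t))
... | false = beyond

d-drop : ∀ j w → d (suc j) w ≡ des (drop j w)
d-drop j w = subst (λ i → length (filterᵇ (i ≤ᵇ_) (descents w)) ≡ des (drop j w))
                   (+-comm j 1) (descents-beyond j 1 w)

drop-∷ : ∀ j (l : List ℕ) → j < length l → Σ ℕ λ x → Σ (List ℕ) λ r → drop j l ≡ x ∷ r
drop-∷ zero (x ∷ l) _ = x , l , refl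
drop-∷ (suc j) (x ∷ l) (s≤s j<|l|) = drop-∷ j l j<|l|

drop-suc : ∀ j (l : List ℕ) {x r} → drop j l ≡ x ∷ r → drop (suc j) l ≡ r
drop-suc zero (x ∷ l) refl = refl
drop-suc (suc j) (y ∷ l) drop-j = drop-suc j l drop-j

elemᵇ-sound : ∀ {z} L → T (elemᵇ z L) → z ∈ L
elemᵇ-sound {z} (y ∷ L) t with Equivalence.to T-∨ t
... | inj₁ z≡ᵇy = here (≡ᵇ⇒≡ z y z≡ᵇy)
... | inj₂ z∈ᵇL = there (elemᵇ-sound L z∈ᵇL)

elemᵇ-complete : ∀ {z} L → z ∈ L → T (elemᵇ z L)
elemᵇ-complete {z} (y ∷ L) (here refl) = Equivalence.from T-∨ (inj₁ (≡⇒≡ᵇ z z refl))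
elemᵇ-complete (y ∷ L) (there z∈L) = Equivalence.from T-∨ (inj₂ (elemᵇ-complete L z∈L))

elemᵇ-delete : ∀ {z x} A B → z ≢ x → elemᵇ z (A ++ B) ≡ elemᵇ z (A ++ x ∷ B)
elemᵇ-delete {z} {x} [] B z≢x with z ≡ᵇ x in e
... | true = ⊥-elim (z≢x (≡ᵇ⇒≡ z x (subst T (sym e) tt)))
... | false = refl
elemᵇ-delete {z} (y ∷ A) B z≢x = cong ((z ≡ᵇ y) ∨_) (elemᵇ-delete A B z≢x)

member? : (L : List ℕ) → Decidable (λ z → T (elemᵇ z L))
member? L z = T? (elemᵇ z L)

filterᵇ-cong : ∀ (p q : ℕ → Bool) l → (∀ {z} → z ∈ l → p z ≡ q z) → filterᵇ p l ≡ filterᵇ q l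
filterᵇ-cong p q [] agree = refl
filterᵇ-cong p q (z ∷ l) agree with p z | q z | agree (here refl) | filterᵇ-cong p q l (agree ∘ there)
... | true  | true  | refl | rest = cong (z ∷_) rest
... | false | false | refl | rest = rest

length-insert : ∀ (σa : List ℕ) x σb → length (σa ++ x ∷ σb) ≡ suc (length (σa ++ σb))
length-insert [] x σb = refl
length-insert (y ∷ σa) x σb = cong suc (length-insert σa x σb)

∈-remove : ∀ {w x : ℕ} σa {σb} → w ∈ σa ++ x ∷ σb → (w ≡ x → w ∈ σa ++ σb) → w ∈ σa ++ σb
∈-remove σa w∈ w≡x⇒w∈ with ∈-++⁻ σa w∈
... | inj₁ w∈σa = ∈-++⁺ˡ w∈σa
... | inj₂ (here w≡x) = w≡x⇒w∈ w≡x
... | inj₂ (there w∈σb) = ∈-++⁺ʳ σa w∈σb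

unique-length-≤ : ∀ {xs ys : List ℕ} → Unique xs → (∀ {z} → z ∈ xs → z ∈ ys) → length xs ≤ length ys
unique-length-≤ {[]} _ _ = z≤n
unique-length-≤ {x ∷ xs} (x∉xs ∷ unique-xs) xs⊆ys with ∈-∃++ (xs⊆ys (here refl))
... | ys₁ , ys₂ , refl =
  subst (suc (length xs) ≤_) (sym (length-insert ys₁ x ys₂))
    (s≤s (unique-length-≤ unique-xs
      (λ z∈xs → ∈-remove ys₁ (xs⊆ys (there z∈xs)) (λ z≡x → ⊥-elim (All.lookup x∉xs z∈xs (sym z≡x))))))

unique-from-splits : ∀ (σ : List ℕ) → (∀ σa z σb → σ ≡ σa ++ z ∷ σb → z ∉ σb) → Unique σ
unique-from-splits [] _ = []
unique-from-splits (z ∷ σ) no-recurrence =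
  ¬Any⇒All¬ σ (no-recurrence [] z σ refl)
  ∷ unique-from-splits σ (λ σa w σb eq → no-recurrence (z ∷ σa) w σb (cong (z ∷_) eq))

-- A list containing every letter of a repetition-free list U, and no longer
-- than U, has no repetitions: a repeated letter would leave too little room.
unique-cover : ∀ {U σ : List ℕ} → Unique U → (∀ {z} → z ∈ U → z ∈ σ) → length σ ≤ length U → Unique σ
unique-cover {U} {σ} unique-U U⊆σ |σ|≤|U| = unique-from-splits σ no-recurrence
  where
  no-recurrence : ∀ σa z σb → σ ≡ σa ++ z ∷ σb → z ∉ σb
  no-recurrence σa z σb refl z∈σb =
    <⇒≱ (subst (_≤ length U) (length-insert σa z σb) |σ|≤|U|)
        (unique-length-≤ unique-U (λ u∈U → ∈-remove σa (U⊆σ u∈U) (λ u≡z → ∈-++⁺ʳ σa (subst (_∈ σb) (sym u≡z) z∈σb))))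

unique-middle : ∀ (σ₁ : List ℕ) {x σ₂} → Unique (σ₁ ++ x ∷ σ₂) → x ∉ σ₁ × x ∉ σ₂
unique-middle [] (x∉σ₂ ∷ _) = (λ ()) , All¬⇒¬Any x∉σ₂
unique-middle (y ∷ σ₁) {x} (y∉rest ∷ unique-rest) with unique-middle σ₁ unique-rest
... | x∉σ₁ , x∉σ₂ = x∉yσ₁ , x∉σ₂
  where
  x∉yσ₁ : x ∉ y ∷ σ₁
  x∉yσ₁ (here x≡y) = All.lookup y∉rest (∈-++⁺ʳ σ₁ (here refl)) (sym x≡y)
  x∉yσ₁ (there x∈σ₁) = x∉σ₁ x∈σ₁

split-at : ∀ {x : ℕ} {p σ} → x ∷ p ⊆ σ → Σ (List ℕ) λ σ₁ → Σ (List ℕ) λ σ₂ → σ ≡ σ₁ ++ x ∷ σ₂ × p ⊆ σ₂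
split-at (y ∷ʳ x∷p⊆σ) with split-at x∷p⊆σ
... | σ₁ , σ₂ , refl , p⊆σ₂ = y ∷ σ₁ , σ₂ , refl , p⊆σ₂
split-at (refl ∷ p⊆σ) = [] , _ , refl , p⊆σ

subwordOn-length : ∀ L {σ} → Unique σ → length (subwordOn L σ) ≤ length L
subwordOn-length L {σ} unique-σ =
  unique-length-≤ (Unique.filter⁺ (member? L) unique-σ)
                  (λ z∈ → elemᵇ-sound L (proj₂ (∈-filter⁻ (member? L) {xs = σ} z∈)))

subwordOn-⊇ : ∀ L {p σ} → (∀ {z} → z ∈ p → z ∈ L) → p ⊆ σ → p ⊆ subwordOn L σ
subwordOn-⊇ L {p} {σ} p∈L p⊆σ =
  subst (_⊆ subwordOn L σ) (List.filter-all (member? L) (All.tabulate (elemᵇ-complete L ∘ p∈L)))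
        (filter⁺ (member? L) (member? L) (λ { refl t → t }) p⊆σ)

subwordOn-self : ∀ {θ σ} → Unique σ → θ ⊆ σ → subwordOn θ σ ≡ θ
subwordOn-self {θ} {σ} unique-σ θ⊆σ =
  sym (≋⇒≡ (to-≋ (≤-antisym (length-mono-≤ θ⊆sub) (subwordOn-length θ unique-σ)) θ⊆sub))
  where
  θ⊆sub : θ ⊆ subwordOn θ σ
  θ⊆sub = subwordOn-⊇ θ (λ z∈θ → z∈θ) θ⊆σ

subword-deletion : ∀ A B {x σ} → Unique σ → x ∷ B ⊆ σ → x ∉ A ++ B →
  Σ (List ℕ) λ u → Σ (List ℕ) λ v →
    subwordOn (A ++ x ∷ B) σ ≡ u ++ x ∷ v × subwordOn (A ++ B) σ ≡ u ++ v × B ⊆ v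
subword-deletion A B {x} unique-σ x∷B⊆σ x∉A++B with split-at x∷B⊆σ
... | σ₁ , σ₂ , refl , B⊆σ₂ =
  subwordOn L σ₁ , subwordOn L σ₂ , with-x , without-x , subwordOn-⊇ L (∈-++⁺ʳ A ∘ there) B⊆σ₂
  where
  L = A ++ x ∷ B
  L′ = A ++ B
  ≢x : ∀ {σ′ z} → x ∉ σ′ → z ∈ σ′ → z ≢ x
  ≢x x∉σ′ z∈σ′ z≡x = x∉σ′ (subst (_∈ _) z≡x z∈σ′)
  agree-on : ∀ σ′ → x ∉ σ′ → subwordOn L′ σ′ ≡ subwordOn L σ′
  agree-on σ′ x∉σ′ = filterᵇ-cong _ _ σ′ (λ z∈σ′ → elemᵇ-delete A B (≢x x∉σ′ z∈σ′))
  with-x : subwordOn L (σ₁ ++ x ∷ σ₂) ≡ subwordOn L σ₁ ++ x ∷ subwordOn L σ₂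
  with-x = trans (List.filter-++ (member? L) σ₁ (x ∷ σ₂))
                 (cong (subwordOn L σ₁ ++_) (List.filter-accept (member? L) (elemᵇ-complete L (∈-++⁺ʳ A (here refl)))))
  without-x : subwordOn L′ (σ₁ ++ x ∷ σ₂) ≡ subwordOn L σ₁ ++ subwordOn L σ₂
  without-x with x∉σ₁ , x∉σ₂ ← unique-middle σ₁ unique-σ = begin
    subwordOn L′ (σ₁ ++ x ∷ σ₂)                    ≡⟨ List.filter-++ (member? L′) σ₁ (x ∷ σ₂) ⟩
    subwordOn L′ σ₁ ++ subwordOn L′ (x ∷ σ₂)       ≡⟨ cong (subwordOn L′ σ₁ ++_)
                                                         (List.filter-reject (member? L′) (x∉A++B ∘ elemᵇ-sound L′)) ⟩
    subwordOn L′ σ₁ ++ subwordOn L′ σ₂             ≡⟨ cong₂ _++_ (agree-on σ₁ x∉σ₁) (agree-on σ₂ x∉σ₂) ⟩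
    subwordOn L σ₁ ++ subwordOn L σ₂               ∎
    where open ≡-Reasoning

pos-minus : ∀ m k → + (m + k) - + m ≡ + k
pos-minus m k = begin
  + (m + k) - + m     ≡⟨ ℤ.[+m]-[+n]≡m⊖n (m + k) m ⟩
  (m + k) ⊖ m         ≡⟨ ℤ.⊖-≥ (m≤m+n m k) ⟩
  + (m + k ∸ m)       ≡⟨ cong +_ (m+n∸m≡n m k) ⟩
  + k                 ∎
  where open ≡-Reasoning

-- The setting of the theorem: θ and π are disjoint repetition-free lists
-- covering [n], and σ is a word of length n having both as subwords.
module Shuffle (n a : ℕ) (π θ σ : List ℕ)
  (length-π : length π ≡ a) (unique-π : Unique π) (unique-θ : Unique θ)
  (θ-disjoint-π : ∀ {x} → x ∈ θ → x ∉ π)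
  (θ-covers : ∀ x → 1 ≤ x → x ≤ n → x ∉ π → x ∈ θ)
  (length-σ : length σ ≡ n) (θ⊆σ : θ ⊆ σ) (π⊆σ : π ⊆ σ) where

  -- σ contains each of 1,…,n and has length n, so it has no repeated letter.
  unique-σ : Unique σ
  unique-σ = unique-cover (Unique.map⁺ suc-injective (Unique.upTo⁺ n)) [n]⊆σ
    (≤-reflexive (trans length-σ (sym (trans (List.length-map suc (upTo n)) (List.length-upTo n)))))
    where
    [n]⊆σ : ∀ {z} → z ∈ map suc (upTo n) → z ∈ σ
    [n]⊆σ z∈[n] with ∈-map⁻ suc z∈[n]
    ... | y , y<n , refl with suc y ∈? π
    ...   | yes z∈π = lookup π⊆σ z∈π
    ...   | no z∉π = lookup θ⊆σ (θ-covers (suc y) (s≤s z≤n) (∈-upTo⁻ y<n) z∉π)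

  -- θ ++ π is a repetition-free list of letters of σ, so |θ| + a ≤ n.
  length-θ : length θ ≤ n ∸ a
  length-θ = m+n≤o⇒m≤o∸n (length θ)
    (subst₂ _≤_ (trans (List.length-++ θ) (cong (λ m → length θ + m) length-π)) length-σ
      (unique-length-≤ (Unique.++⁺ unique-θ unique-π (λ (x∈θ , x∈π) → θ-disjoint-π x∈θ x∈π)) θπ⊆σ))
    where
    θπ⊆σ : ∀ {z} → z ∈ θ ++ π → z ∈ σ
    θπ⊆σ z∈θπ with ∈-++⁻ θ z∈θπ
    ... | inj₁ z∈θ = lookup θ⊆σ z∈θ
    ... | inj₂ z∈π = lookup π⊆σ z∈π

  -- σ_{j+1} is the subword of σ on θ and π(j+1),…,π(a); for j = a this holds
  -- because the subword of σ on θ is θ itself.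
  σ-as-subword : ∀ j → j ≤ a → sigmaSub a θ π σ (suc j) ≡ subwordOn (θ ++ drop j π) σ
  σ-as-subword j j≤a with suc j ≤ᵇ a | ≤ᵇ-reflects-≤ (suc j) a
  ... | true  | _ = refl
  ... | false | ofⁿ j≮a = sym (begin
    subwordOn (θ ++ drop j π) σ   ≡⟨ cong (λ r → subwordOn (θ ++ r) σ) (List.drop-all j π (≤-trans (≤-reflexive length-π) (≮⇒≥ j≮a))) ⟩
    subwordOn (θ ++ []) σ         ≡⟨ cong (λ L → subwordOn L σ) (List.++-identityʳ θ) ⟩
    subwordOn θ σ                 ≡⟨ subwordOn-self unique-σ θ⊆σ ⟩
    θ                             ∎)
    where open ≡-Reasoning

  suffix-⊆σ : ∀ j {x π′} → drop j π ≡ x ∷ π′ → x ∷ π′ ⊆ σ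
  suffix-⊆σ j drop-j = subst (_⊆ σ) drop-j (⊆-trans (drop-⊆ j π) π⊆σ)

  suffix-head-fresh : ∀ j {x π′} → drop j π ≡ x ∷ π′ → x ∉ θ ++ π′
  suffix-head-fresh j {x} {π′} drop-j x∈θπ′ with ∈-++⁻ θ x∈θπ′
  ... | inj₁ x∈θ = θ-disjoint-π x∈θ (lookup (drop-⊆ j π) (subst (x ∈_) (sym drop-j) (here refl)))
  ... | inj₂ x∈π′ with subst Unique drop-j (Unique.drop⁺ j unique-π)
  ...   | x∉π′ ∷ _ = All¬⇒¬Any x∉π′ x∈π′

  excess-at : ∀ j {x π′} → j < a → drop j π ≡ x ∷ π′ → Σ ℕ λ t →
    maj (sigmaSub a θ π σ (suc j)) ≡ maj (sigmaSub a θ π σ (suc (suc j))) + d (suc j) π + t × t ≤ n ∸ a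
  excess-at j {x} {π′} j<a drop-j
    with subword-deletion θ π′ unique-σ (suffix-⊆σ j drop-j) (suffix-head-fresh j drop-j)
  ... | u , v , σ-with-x , σ-without-x , π′⊆v with maj-deletion u x π′⊆v
  ... | t , maj-eq , t+|π′|≤|u|+|v| = t , (begin
    maj (sigmaSub a θ π σ (suc j))                          ≡⟨ cong maj σᵢ ⟩
    maj (u ++ x ∷ v)                                        ≡⟨ maj-eq ⟩
    maj (u ++ v) + des (x ∷ π′) + t                         ≡⟨ cong₂ (λ m e → m + e + t) (cong maj σᵢ₊₁) dᵢ ⟨
    maj (sigmaSub a θ π σ (suc (suc j))) + d (suc j) π + t  ∎) , t≤n∸a
    where
    open ≡-Reasoning
    σᵢ : sigmaSub a θ π σ (suc j) ≡ u ++ x ∷ v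
    σᵢ = trans (σ-as-subword j (<⇒≤ j<a)) (trans (cong (λ r → subwordOn (θ ++ r) σ) drop-j) σ-with-x)
    σᵢ₊₁ : sigmaSub a θ π σ (suc (suc j)) ≡ u ++ v
    σᵢ₊₁ = trans (σ-as-subword (suc j) j<a) (trans (cong (λ r → subwordOn (θ ++ r) σ) (drop-suc j π drop-j)) σ-without-x)
    dᵢ : d (suc j) π ≡ des (x ∷ π′)
    dᵢ = trans (d-drop j π) (cong des drop-j)
    room : length u + length v ≤ length θ + length π′
    room = subst₂ _≤_ (List.length-++ u) (List.length-++ θ)
      (≤-pred (subst₂ _≤_ (length-insert u x v) (length-insert θ x π′)
        (subst (λ w → length w ≤ length (θ ++ x ∷ π′)) σ-with-x (subwordOn-length (θ ++ x ∷ π′) unique-σ))))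
    t≤n∸a : t ≤ n ∸ a
    t≤n∸a = ≤-trans (+-cancelʳ-≤ (length π′) t (length θ) (≤-trans t+|π′|≤|u|+|v| room)) length-θ

  excess : ∀ j → j < a → Σ ℕ λ t →
    maj (sigmaSub a θ π σ (suc j)) ≡ maj (sigmaSub a θ π σ (suc (suc j))) + d (suc j) π + t × t ≤ n ∸ a
  excess j j<a with x , π′ , drop-j ← drop-∷ j π (subst (j <_) (sym length-π) j<a) = excess-at j j<a drop-j

mainTheorem4 : (n a : ℕ) → 1 ≤ n → 1 ≤ a → a ≤ n →
    (π θ σ : List ℕ) →
    length π ≡ a → Unique π → All (λ x → 1 ≤ x × x ≤ n) π →
    Unique θ →
    (∀ x → x ∈ θ → (1 ≤ x × x ≤ n) × x ∉ π) →
    (∀ x → 1 ≤ x → x ≤ n → x ∉ π → x ∈ θ) →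
    length σ ≡ n → θ ⊆ σ → π ⊆ σ →
    (i : ℕ) → 1 ≤ i → i ≤ a →
    let t = (+ maj (sigmaSub a θ π σ i) - + maj (sigmaSub a θ π σ (suc i))) - + d i π
    in (+ 0 ≤ℤ t) × (t ≤ℤ + (n ∸ a))
mainTheorem4 n a _ _ _ π θ σ length-π unique-π _ unique-θ θ-spec θ-covers length-σ θ⊆σ π⊆σ (suc j) _ j<a
  with t , maj-eq , t≤n∸a ← Shuffle.excess n a π θ σ length-π unique-π unique-θ (λ x∈θ → proj₂ (θ-spec _ x∈θ))
                                             θ-covers length-σ θ⊆σ π⊆σ j j<a
  = subst (λ s → (+ 0 ≤ℤ s) × (s ≤ℤ + (n ∸ a))) (sym tᵢ≡t) (+≤+ z≤n , +≤+ t≤n∸a)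
  where
  open ≡-Reasoning
  M = maj (sigmaSub a θ π σ (suc (suc j)))
  D = d (suc j) π
  tᵢ≡t : (+ maj (sigmaSub a θ π σ (suc j)) - + M) - + D ≡ + t
  tᵢ≡t = begin
    (+ maj (sigmaSub a θ π σ (suc j)) - + M) - + D   ≡⟨ cong (λ m → (+ m - + M) - + D) (trans maj-eq (+-assoc M D t)) ⟩
    (+ (M + (D + t)) - + M) - + D                    ≡⟨ cong (_- + D) (pos-minus M (D + t)) ⟩
    + (D + t) - + D                                  ≡⟨ pos-minus D t ⟩
    + t                                              ∎
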